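{- Let $S$ be an S-tree. If $v\in\operatorname{Core}(S)$, then $|N(v)\cap\operatorname{Supp}(S)|\geq 2$.
   Context: For a tree $S$, $\mathcal{N}(S)$ is the null space of its adjacency matrix and $\operatorname{Supp}(S)=\{w\in V(S): x_w\neq0\text{ for some }x\in\mathcal{N}(S)\}$. $S$ is an S-tree if $N[\operatorname{Supp}(S)]=V(S)$, where $N[X]=\bigcup_{w\in X}(N(w)\cup\{w\})$. $\operatorname{Core}(S)=\bigcup_{w\in\operatorname{Supp}(S)}N(w)$.
   Formalization: The null space $\mathcal{N}(S)$, and with it $\operatorname{Supp}(S)$, is taken over the rationals rather than the reals. -}

module Defs where

open import Data.Nat using (ℕ; zero; suc; _≤_)
open import Data.Fin using (Fin)
import Data.Fin as F
open import Data.Bool using (Bool; true; false; if_then_else_)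
open import Data.List using (List; []; _∷_; length; head; last)
open import Data.List.Relation.Unary.Unique.Propositional using (Unique)
open import Data.Maybe using (just)
open import Data.Product using (Σ; ∃; _×_; _,_)
open import Data.Sum using (_⊎_)
open import Data.Empty using (⊥)
open import Data.Unit using (⊤)
open import Data.Rational using (ℚ; 0ℚ; _+_; _*_)
open import Relation.Binary.PropositionalEquality using (_≡_; _≢_)
open import Relation.Nullary using (¬_)

record Graph (n : ℕ) : Set where
  field
    adj    : Fin n → Fin n → Bool
    sym    : ∀ i j → adj i j ≡ adj j i
    irrefl : ∀ i → adj i i ≡ false

open Graph public

Adj : ∀ {n} → Graph n → Fin n → Fin n → Set
Adj G u w = adj G u w ≡ true

Chain : ∀ {n} → Graph n → List (Fin n) → Set
Chain G []             = ⊤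
Chain G (u ∷ [])       = ⊤
Chain G (u ∷ w ∷ rest) = Adj G u w × Chain G (w ∷ rest)

Walk : ∀ {n} → Graph n → Fin n → Fin n → List (Fin n) → Set
Walk G u w p = head p ≡ just u × last p ≡ just w × Chain G p

Connected : ∀ {n} → Graph n → Set
Connected G = ∀ u w → ∃ λ p → Walk G u w p

IsCycle : ∀ {n} → Graph n → List (Fin n) → Set
IsCycle G p = 3 ≤ length p × Unique p × Chain G p
              × ∃ λ u → ∃ λ w → head p ≡ just u × last p ≡ just w × Adj G w u

Acyclic : ∀ {n} → Graph n → Set
Acyclic G = ∀ p → ¬ IsCycle G p

IsTree : ∀ {n} → Graph n → Set
IsTree G = Connected G × Acyclic G

Σℚ : ∀ n → (Fin n → ℚ) → ℚ
Σℚ zero    f = 0ℚ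
Σℚ (suc n) f = f F.zero + Σℚ n (λ i → f (F.suc i))

AdjMat : ∀ {n} → Graph n → Fin n → Fin n → ℚ
AdjMat G i j = if adj G i j then Data.Rational.1ℚ else 0ℚ

InNullSpace : ∀ {n} → Graph n → (Fin n → ℚ) → Set
InNullSpace {n} G x = ∀ i → Σℚ n (λ j → AdjMat G i j * x j) ≡ 0ℚ

InSupp : ∀ {n} → Graph n → Fin n → Set
InSupp G w = ∃ λ x → InNullSpace G x × x w ≢ 0ℚ

InClosedNbhdSupp : ∀ {n} → Graph n → Fin n → Set
InClosedNbhdSupp G u = ∃ λ w → InSupp G w × (w ≡ u ⊎ Adj G w u)

IsSTree : ∀ {n} → Graph n → Set
IsSTree G = IsTree G × (∀ u → InClosedNbhdSupp G u)

InCore : ∀ {n} → Graph n → Fin n → Set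
InCore G v = ∃ λ w → InSupp G w × Adj G w v

module Submission where

-- Let v ∈ Core(S), witnessed by a support vertex w adjacent to v
-- and a null vector x with x_w ≠ 0.  Row v of the equation A x = 0 reads
--     Σ_{u ∈ N(v)} x_u = 0 .
-- The summand at w is nonzero, so the sum cannot be concentrated at w alone:
-- some other vertex u ≠ w has a nonzero summand A_vu x_u.  Then A_vu ≠ 0,
-- i.e. u ∈ N(v), and x_u ≠ 0 exhibits u ∈ Supp(S) via the same vector x.
-- The argument uses only the null-space equation, so it holds in every graph.

open import Defs
open import Data.Nat using (ℕ; zero; suc)
open import Data.Fin using (Fin)
import Data.Fin as F
import Data.Fin.Properties as FinP
open import Data.Product using (∃; _×_; _,_)
open import Data.Sum using (_⊎_; inj₁; inj₂)
open import Data.Bool using (true; false)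
open import Data.Rational using (ℚ; 0ℚ; _+_; _*_)
import Data.Rational.Properties as ℚP
open import Relation.Nullary using (contradiction)
open import Relation.Nullary.Decidable using (_⊎-dec_)
open import Relation.Binary.PropositionalEquality
  using (_≡_; _≢_; refl; trans; cong; cong₂; module ≡-Reasoning)
  renaming (sym to ≡-sym)

ConcentratedAt : ∀ {n} → Fin n → (Fin n → ℚ) → Set
ConcentratedAt w f = ∀ j → j ≡ w ⊎ f j ≡ 0ℚ

Σℚ-zero : ∀ n (f : Fin n → ℚ) → (∀ j → f j ≡ 0ℚ) → Σℚ n f ≡ 0ℚ
Σℚ-zero zero    f f≡0 = refl
Σℚ-zero (suc n) f f≡0 = begin
  f F.zero + Σℚ n (λ i → f (F.suc i)) ≡⟨ cong₂ _+_ (f≡0 F.zero) (Σℚ-zero n _ (λ i → f≡0 (F.suc i))) ⟩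
  0ℚ + 0ℚ                             ≡⟨ ℚP.+-identityˡ 0ℚ ⟩
  0ℚ                                  ∎
  where open ≡-Reasoning

Σℚ-concentrated : ∀ n (f : Fin n → ℚ) (w : Fin n) → ConcentratedAt w f → Σℚ n f ≡ f w
Σℚ-concentrated (suc n) f F.zero conc = begin
  f F.zero + Σℚ n (λ i → f (F.suc i)) ≡⟨ cong (f F.zero +_) (Σℚ-zero n _ tail≡0) ⟩
  f F.zero + 0ℚ                       ≡⟨ ℚP.+-identityʳ (f F.zero) ⟩
  f F.zero                            ∎
  where
  open ≡-Reasoning
  tail≡0 : ∀ i → f (F.suc i) ≡ 0ℚ
  tail≡0 i with conc (F.suc i)
  ... | inj₂ fi≡0 = fi≡0
Σℚ-concentrated (suc n) f (F.suc w) conc = begin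
  f F.zero + Σℚ n (λ i → f (F.suc i)) ≡⟨ cong (_+ Σℚ n (λ i → f (F.suc i))) head≡0 ⟩
  0ℚ + Σℚ n (λ i → f (F.suc i))       ≡⟨ ℚP.+-identityˡ _ ⟩
  Σℚ n (λ i → f (F.suc i))            ≡⟨ Σℚ-concentrated n (λ i → f (F.suc i)) w tail-conc ⟩
  f (F.suc w)                         ∎
  where
  open ≡-Reasoning
  head≡0 : f F.zero ≡ 0ℚ
  head≡0 with conc F.zero
  ... | inj₂ f0≡0 = f0≡0
  tail-conc : ConcentratedAt w (λ i → f (F.suc i))
  tail-conc i with conc (F.suc i)
  ... | inj₁ si≡sw = inj₁ (FinP.suc-injective si≡sw)
  ... | inj₂ fi≡0  = inj₂ fi≡0

-- If a finite sum vanishes but its summand at w does not, then some other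
-- summand is nonzero.  (Constructive: ConcentratedAt is decidable on Fin n.)
second-nonzero-summand : ∀ n (f : Fin n → ℚ) (w : Fin n) →
  Σℚ n f ≡ 0ℚ → f w ≢ 0ℚ → ∃ λ j → j ≢ w × f j ≢ 0ℚ
second-nonzero-summand n f w Σf≡0 fw≢0
  with FinP.¬∀⟶∃¬ n (λ j → j ≡ w ⊎ f j ≡ 0ℚ)
         (λ j → (j FinP.≟ w) ⊎-dec (f j ℚP.≟ 0ℚ))
         (λ conc → fw≢0 (trans (≡-sym (Σℚ-concentrated n f w conc)) Σf≡0))
... | j , ¬[j≡w⊎fj≡0] = j , (λ j≡w → ¬[j≡w⊎fj≡0] (inj₁ j≡w)) , (λ fj≡0 → ¬[j≡w⊎fj≡0] (inj₂ fj≡0))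

adj-sym : ∀ {n} (G : Graph n) {u w : Fin n} → Adj G u w → Adj G w u
adj-sym G {u} {w} uw = trans (sym G w u) uw

adjacent-summand : ∀ {n} (G : Graph n) (x : Fin n → ℚ) (v u : Fin n) →
  Adj G v u → x u ≢ 0ℚ → AdjMat G v u * x u ≢ 0ℚ
adjacent-summand G x v u vu xu≢0 rewrite vu = λ 1x≡0 → xu≢0 (trans (≡-sym (ℚP.*-identityˡ (x u))) 1x≡0)

nonzero-summand : ∀ {n} (G : Graph n) (x : Fin n → ℚ) (v u : Fin n) →
  AdjMat G v u * x u ≢ 0ℚ → Adj G v u × x u ≢ 0ℚ
nonzero-summand G x v u summand≢0 with adj G v u in vu
... | false = contradiction (ℚP.*-zeroˡ (x u)) summand≢0
... | true  = refl , λ xu≡0 → summand≢0 (trans (ℚP.*-identityˡ (x u)) xu≡0)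

null-vector-balance : ∀ {n} (G : Graph n) (x : Fin n → ℚ) → InNullSpace G x →
  (v w : Fin n) → Adj G v w → x w ≢ 0ℚ →
  ∃ λ u → u ≢ w × Adj G v u × x u ≢ 0ℚ
null-vector-balance {n} G x Ax≡0 v w vw xw≢0
  with second-nonzero-summand n (λ u → AdjMat G v u * x u) w (Ax≡0 v)
         (adjacent-summand G x v w vw xw≢0)
... | u , u≢w , summand≢0 with nonzero-summand G x v u summand≢0
...   | vu , xu≢0 = u , u≢w , vu , xu≢0

mainTheorem16 : ∀ (n : ℕ) (S : Graph n) → IsSTree S → (v : Fin n) → InCore S v →
    ∃ λ w₁ → ∃ λ w₂ → w₁ ≢ w₂ × Adj S v w₁ × InSupp S w₁ × Adj S v w₂ × InSupp S w₂
mainTheorem16 n S _ v (w , (x , Ax≡0 , xw≢0) , wv)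
  with null-vector-balance S x Ax≡0 v w (adj-sym S wv) xw≢0
... | u , u≢w , vu , xu≢0 =
  w , u , (λ w≡u → u≢w (≡-sym w≡u)) , adj-sym S wv , (x , Ax≡0 , xw≢0) , vu , (x , Ax≡0 , xu≢0)
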